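{- Run the colouring procedure (described in the context) on an Eulerian directed multigraph $G=(V,E)$. At every step of the execution there is exactly one needle vertex.
   Context: $G=(V,E)$ is a finite directed multigraph (loops and parallel edges allowed), Eulerian: strongly connected and every vertex has in-degree equal to out-degree. For a vertex $v$ and colour $X$, $d^+(v,X)$ (resp. $d^-(v,X)$) is the number of edges leaving (resp. entering) $v$ currently coloured $X$. Colouring procedure: each edge has a colour in $\{\textsc{Black},\textsc{Red},\textsc{Green},\textsc{Dashed}\}$, initially all \textsc{Black}. Choose a start vertex $v_0$; the current vertex is $u=v_0$, and $v_0$ is marked reached. Repeat: if some \textsc{Black} edge $wu$ enters the current vertex $u$, pick one, colour it \textsc{Red} if $w$ was not yet reached (and mark $w$ reached), otherwise \textsc{Green}, and make $w$ current (forward step). Otherwise: if some \textsc{Green} edge $uw$ leaves $u$, colour it \textsc{Dashed}, output it, make $w$ current; else if $u\ne v_0$, colour the unique \textsc{Red} edge $uw$ leaving $u$ \textsc{Dashed}, output it, make $w$ current (backtracking steps); else terminate. Needle vertex: with $u$ the current vertex, a vertex $w$ is a needle vertex iff either $w=u$ and $d^+(w,\textsc{Black})=d^-(w,\textsc{Black})$, or $w\ne u$ and $d^+(w,\textsc{Black})=d^-(w,\textsc{Black})+1$. -}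

module Defs where

open import Data.Nat using (ℕ; zero; suc; _+_)
open import Data.Fin using (Fin; zero; suc)
open import Data.Bool using (Bool; true; false; if_then_else_)
open import Data.Product using (Σ; ∃; _×_; _,_; ∃!)
open import Data.Sum using (_⊎_)
open import Relation.Nullary using (¬_)
open import Relation.Binary.PropositionalEquality using (_≡_; _≢_)
open import Relation.Binary.Construct.Closure.ReflexiveTransitive using (Star)

record Graph : Set where
  field
    n   : ℕ
    m   : ℕ
    src : Fin m → Fin n
    tgt : Fin m → Fin n

module _ (G : Graph) where
  open Graph G

  Adj : Fin n → Fin n → Set
  Adj u v = ∃ λ e → src e ≡ u × tgt e ≡ v

  StronglyConnected : Set
  StronglyConnected = ∀ u v → Star Adj u v

  countE : ∀ {k} → (Fin k → Bool) → ℕ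
  countE {zero}  p = 0
  countE {suc k} p = (if p zero then 1 else 0) + countE (λ i → p (suc i))

open Data.Fin using (_≟_)
open import Relation.Nullary using (does)

outDeg inDeg : (G : Graph) → Fin (Graph.n G) → ℕ
outDeg G v = countE G (λ e → does (Graph.src G e ≟ v))
inDeg  G v = countE G (λ e → does (Graph.tgt G e ≟ v))

Eulerian : Graph → Set
Eulerian G = StronglyConnected G × (∀ v → outDeg G v ≡ inDeg G v)

data Colour : Set where
  Black Red Green Dashed : Colour

_==ᶜ_ : Colour → Colour → Bool
Black  ==ᶜ Black  = true
Red    ==ᶜ Red    = true
Green  ==ᶜ Green  = true
Dashed ==ᶜ Dashed = true
_      ==ᶜ _      = false

record State (G : Graph) : Set where
  constructor ⟨_,_,_⟩
  field
    colour  : Fin (Graph.m G) → Colour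
    reached : Fin (Graph.n G) → Bool
    current : Fin (Graph.n G)

module Procedure (G : Graph) (v₀ : Fin (Graph.n G)) where
  open Graph G

  dOut dIn : (Fin m → Colour) → Fin n → Colour → ℕ
  dOut c v X = countE G (λ e → does (src e ≟ v) Data.Bool.∧ (c e ==ᶜ X))
  dIn  c v X = countE G (λ e → does (tgt e ≟ v) Data.Bool.∧ (c e ==ᶜ X))

  setC : (Fin m → Colour) → Fin m → Colour → Fin m → Colour
  setC c e X e' = if does (e' ≟ e) then X else c e'

  mark : (Fin n → Bool) → Fin n → Fin n → Bool
  mark r w w' = if does (w' ≟ w) then true else r w'

  initial : State G
  initial = ⟨ (λ _ → Black) , mark (λ _ → false) v₀ , v₀ ⟩

  data Step : State G → State G → Set where
    forward-red : ∀ {c r u} e → c e ≡ Black → tgt e ≡ u → r (src e) ≡ false →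
      Step ⟨ c , r , u ⟩ ⟨ setC c e Red , mark r (src e) , src e ⟩
    forward-green : ∀ {c r u} e → c e ≡ Black → tgt e ≡ u → r (src e) ≡ true →
      Step ⟨ c , r , u ⟩ ⟨ setC c e Green , r , src e ⟩
    back-green : ∀ {c r u} e →
      (∀ e' → tgt e' ≡ u → ¬ (c e' ≡ Black)) →
      c e ≡ Green → src e ≡ u →
      Step ⟨ c , r , u ⟩ ⟨ setC c e Dashed , r , tgt e ⟩
    back-red : ∀ {c r u} e →
      (∀ e' → tgt e' ≡ u → ¬ (c e' ≡ Black)) →
      (∀ e' → src e' ≡ u → ¬ (c e' ≡ Green)) →
      u ≢ v₀ →
      c e ≡ Red → src e ≡ u →
      Step ⟨ c , r , u ⟩ ⟨ setC c e Dashed , r , tgt e ⟩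

  Reachable : State G → Set
  Reachable s = Star Step initial s

  Needle : State G → Fin n → Set
  Needle s w =
    (w ≡ State.current s × dOut (State.colour s) w Black ≡ dIn (State.colour s) w Black)
    ⊎ (w ≢ State.current s × dOut (State.colour s) w Black ≡ suc (dIn (State.colour s) w Black))

{-# OPTIONS --safe #-}
-- Throughout the execution the Black edges have the degrees of a trail from
-- some vertex N to the current vertex u:
--   d⁺(v,Black) + [v = u] = d⁻(v,Black) + [v = N]   for every v.
-- Initially all degrees are balanced and N = u = v₀.  A forward step removes
-- the last edge of the trail and keeps N.  A backward step happens only when
-- no Black edge enters u, which forces N = u; so the Black degrees are
-- balanced and N can follow u to its new position.  Under the invariant, w is
-- a needle vertex iff d⁺(w,Black) + [w = u] = d⁻(w,Black) + 1, i.e. iff w = N.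
module Submission where

open import Defs
open import Algebra.Properties.CommutativeSemigroup using (xy∙z≈zy∙x; xy∙z≈xz∙y)
open import Data.Bool using (Bool; true; false; _∧_; if_then_else_)
open import Data.Bool.Properties using (∧-identityʳ; ∧-zeroʳ)
open import Data.Fin using (Fin; zero; suc; _≟_)
import Data.Fin.Properties as Fin
open import Data.Nat using (ℕ; zero; suc; _+_)
open import Data.Nat.Properties
  using ( +-assoc; +-comm; +-identityʳ; +-cancelˡ-≡; +-cancelʳ-≡; suc-injective
        ; +-commutativeSemigroup)
open import Data.Product using (∃; ∃!; _×_; _,_)
open import Data.Sum using (_⊎_; inj₁; inj₂)
open import Function.Base using (_∘_; id)
open import Function.Bundles using (_⇔_; mk⇔; Equivalence)
open import Relation.Nullary using (yes; no; does; contradiction)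
open import Relation.Nullary.Decidable using (dec-true; dec-false)
open import Relation.Binary.PropositionalEquality
  using (_≡_; _≢_; refl; sym; trans; cong; cong₂; module ≡-Reasoning)
open import Relation.Binary.Construct.Closure.ReflexiveTransitive using (Star; ε; _◅_)

open ≡-Reasoning

𝟙 : Bool → ℕ
𝟙 b = if b then 1 else 0

δ : ∀ {n} → Fin n → Fin n → ℕ
δ a b = 𝟙 (does (a ≟ b))

+-δ-refl : ∀ {n} x (a : Fin n) → x + δ a a ≡ suc x
+-δ-refl x a = begin
  x + δ a a ≡⟨ cong (λ b → x + 𝟙 b) (dec-true (a ≟ a) refl) ⟩
  x + 1     ≡⟨ +-comm x 1 ⟩
  suc x     ∎

+-δ-≢ : ∀ {n} x {a b : Fin n} → a ≢ b → x + δ a b ≡ x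
+-δ-≢ x {a} {b} a≢b = trans (cong (λ b → x + 𝟙 b) (dec-false (a ≟ b) a≢b)) (+-identityʳ x)

δ≡1⇒≡ : ∀ {n} {a b : Fin n} → δ a b ≡ 1 → a ≡ b
δ≡1⇒≡ {a = a} {b} with a ≟ b
... | yes a≡b = λ _ → a≡b
... | no  _   = λ ()

module _ {n : ℕ} where

  -- Adding one edge `to → from` would balance every vertex.
  record TrailDegrees (d⁺ d⁻ : Fin n → ℕ) (from to : Fin n) : Set where
    constructor trailDegrees
    field balance : ∀ v → d⁺ v + δ to v ≡ d⁻ v + δ from v

  -- `Procedure.Needle s` unfolds to this condition on the Black degrees.
  NeedleCondition : (d⁺ d⁻ : Fin n → ℕ) → (u w : Fin n) → Set
  NeedleCondition d⁺ d⁻ u w = (w ≡ u × d⁺ w ≡ d⁻ w) ⊎ (w ≢ u × d⁺ w ≡ suc (d⁻ w))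

  variable
    d⁺ d⁻ e⁺ e⁻ : Fin n → ℕ
    N u w : Fin n

  balanced⇒trailDegrees : (∀ v → d⁺ v ≡ d⁻ v) → TrailDegrees d⁺ d⁻ w w
  balanced⇒trailDegrees {w = w} bal = trailDegrees λ v → cong (_+ δ w v) (bal v)

  trailDegrees-dropLast : TrailDegrees d⁺ d⁻ N u →
    (∀ v → d⁺ v ≡ e⁺ v + δ w v) → (∀ v → d⁻ v ≡ e⁻ v + δ u v) →
    TrailDegrees e⁺ e⁻ N w
  trailDegrees-dropLast {d⁺ = d⁺} {d⁻} {N} {u} {e⁺} {w} {e⁻} (trailDegrees trail) d⁺≡ d⁻≡ =
    trailDegrees λ v → begin
      e⁺ v + δ w v   ≡⟨ sym (d⁺≡ v) ⟩
      d⁺ v           ≡⟨ +-cancelʳ-≡ (δ u v) (d⁺ v) (e⁻ v + δ N v) (d⁺+δu≡e⁻+δN+δu v) ⟩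
      e⁻ v + δ N v   ∎
    where
    d⁺+δu≡e⁻+δN+δu : ∀ v → d⁺ v + δ u v ≡ e⁻ v + δ N v + δ u v
    d⁺+δu≡e⁻+δN+δu v = begin
      d⁺ v + δ u v          ≡⟨ trail v ⟩
      d⁻ v + δ N v          ≡⟨ cong (_+ δ N v) (d⁻≡ v) ⟩
      e⁻ v + δ u v + δ N v  ≡⟨ xy∙z≈xz∙y +-commutativeSemigroup (e⁻ v) (δ u v) (δ N v) ⟩
      e⁻ v + δ N v + δ u v  ∎

  trailDegrees-closed : TrailDegrees d⁺ d⁻ N u → d⁻ u ≡ 0 → ∀ v → d⁺ v ≡ d⁻ v
  trailDegrees-closed {d⁺ = d⁺} {d⁻} {N} {u} (trailDegrees trail) d⁻u≡0 v with N ≟ u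
  ... | yes refl = +-cancelʳ-≡ (δ N v) (d⁺ v) (d⁻ v) (trail v)
  ... | no  N≢u  = contradiction 1+d⁺u≡0 λ ()
    where
    1+d⁺u≡0 : suc (d⁺ u) ≡ 0
    1+d⁺u≡0 = begin
      suc (d⁺ u)   ≡⟨ sym (+-δ-refl (d⁺ u) u) ⟩
      d⁺ u + δ u u ≡⟨ trail u ⟩
      d⁻ u + δ N u ≡⟨ +-δ-≢ (d⁻ u) N≢u ⟩
      d⁻ u         ≡⟨ d⁻u≡0 ⟩
      0            ∎

  needleCondition⇔ : NeedleCondition d⁺ d⁻ u w ⇔ d⁺ w + δ u w ≡ suc (d⁻ w)
  needleCondition⇔ {d⁺ = d⁺} {d⁻} {u} {w} = mk⇔ to from
    where
    to : NeedleCondition d⁺ d⁻ u w → d⁺ w + δ u w ≡ suc (d⁻ w)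
    to (inj₁ (refl , d⁺≡d⁻)) = trans (+-δ-refl (d⁺ w) w) (cong suc d⁺≡d⁻)
    to (inj₂ (w≢u , d⁺≡1+d⁻)) = trans (+-δ-≢ (d⁺ w) (w≢u ∘ sym)) d⁺≡1+d⁻

    from : d⁺ w + δ u w ≡ suc (d⁻ w) → NeedleCondition d⁺ d⁻ u w
    from eq with w ≟ u
    ... | yes refl = inj₁ (refl , suc-injective (trans (sym (+-δ-refl (d⁺ w) w)) eq))
    ... | no  w≢u  = inj₂ (w≢u , trans (sym (+-δ-≢ (d⁺ w) (w≢u ∘ sym))) eq)

  trailDegrees⇒needle⇔start : TrailDegrees d⁺ d⁻ N u → NeedleCondition d⁺ d⁻ u w ⇔ N ≡ w
  trailDegrees⇒needle⇔start {d⁺ = d⁺} {d⁻} {N} {u} {w} (trailDegrees trail) = mk⇔ to from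
    where
    to : NeedleCondition d⁺ d⁻ u w → N ≡ w
    to needle = δ≡1⇒≡ (+-cancelˡ-≡ (d⁻ w) (δ N w) 1 (begin
      d⁻ w + δ N w ≡⟨ sym (trail w) ⟩
      d⁺ w + δ u w ≡⟨ Equivalence.to (needleCondition⇔ {d⁺ = d⁺} {d⁻}) needle ⟩
      suc (d⁻ w)   ≡⟨ +-comm 1 (d⁻ w) ⟩
      d⁻ w + 1     ∎))

    from : N ≡ w → NeedleCondition d⁺ d⁻ u w
    from refl = Equivalence.from (needleCondition⇔ {d⁺ = d⁺} {d⁻})
      (trans (trail N) (+-δ-refl (d⁻ N) N))

  trailDegrees⇒∃!needle : TrailDegrees d⁺ d⁻ N u → ∃! _≡_ (NeedleCondition d⁺ d⁻ u)
  trailDegrees⇒∃!needle {d⁺ = d⁺} {d⁻} {N} {u} trail =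
    N , Equivalence.from needle⇔start refl , Equivalence.to needle⇔start
    where
    needle⇔start : ∀ {w} → NeedleCondition d⁺ d⁻ u w ⇔ N ≡ w
    needle⇔start = trailDegrees⇒needle⇔start {d⁺ = d⁺} {d⁻} trail

module _ (G : Graph) where

  countE-cong : ∀ {k} {p q : Fin k → Bool} → (∀ x → p x ≡ q x) → countE G p ≡ countE G q
  countE-cong {zero}  _   = refl
  countE-cong {suc k} p≗q = cong₂ _+_ (cong 𝟙 (p≗q zero)) (countE-cong (p≗q ∘ suc))

  countE-false : ∀ {k} {p : Fin k → Bool} → (∀ x → p x ≡ false) → countE G p ≡ 0
  countE-false {zero}  _       = refl
  countE-false {suc k} p≗false = cong₂ _+_ (cong 𝟙 (p≗false zero)) (countE-false (p≗false ∘ suc))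

  countE-update : ∀ {k} (p q : Fin k → Bool) e → (∀ x → x ≢ e → p x ≡ q x) →
    countE G p + 𝟙 (q e) ≡ countE G q + 𝟙 (p e)
  countE-update p q zero agree = begin
    𝟙 (p zero) + countE G (p ∘ suc) + 𝟙 (q zero)
      ≡⟨ cong (λ k → 𝟙 (p zero) + k + 𝟙 (q zero)) (countE-cong λ x → agree (suc x) λ ()) ⟩
    𝟙 (p zero) + countE G (q ∘ suc) + 𝟙 (q zero)
      ≡⟨ xy∙z≈zy∙x +-commutativeSemigroup (𝟙 (p zero)) _ _ ⟩
    𝟙 (q zero) + countE G (q ∘ suc) + 𝟙 (p zero) ∎
  countE-update p q (suc e) agree = begin
    𝟙 (p zero) + countE G (p ∘ suc) + 𝟙 (q (suc e))
      ≡⟨ +-assoc (𝟙 (p zero)) _ _ ⟩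
    𝟙 (p zero) + (countE G (p ∘ suc) + 𝟙 (q (suc e)))
      ≡⟨ cong₂ _+_ (cong 𝟙 (agree zero λ ())) (countE-update (p ∘ suc) (q ∘ suc) e agree-suc) ⟩
    𝟙 (q zero) + (countE G (q ∘ suc) + 𝟙 (p (suc e)))
      ≡⟨ sym (+-assoc (𝟙 (q zero)) _ _) ⟩
    𝟙 (q zero) + countE G (q ∘ suc) + 𝟙 (p (suc e)) ∎
    where
    agree-suc : ∀ x → x ≢ e → p (suc x) ≡ q (suc x)
    agree-suc x x≢e = agree (suc x) (x≢e ∘ Fin.suc-injective)

==ᶜBlack-≢ : ∀ {X} → X ≢ Black → (X ==ᶜ Black) ≡ false
==ᶜBlack-≢ {Black}  X≢Black = contradiction refl X≢Black
==ᶜBlack-≢ {Red}    _       = refl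
==ᶜBlack-≢ {Green}  _       = refl
==ᶜBlack-≢ {Dashed} _       = refl

module NeedleInvariant (G : Graph) (v₀ : Fin (Graph.n G)) where
  open Graph G
  open Procedure G v₀

  blackDegree : (Fin m → Fin n) → (Fin m → Colour) → Fin n → ℕ
  blackDegree end c v = countE G (λ e → does (end e ≟ v) ∧ (c e ==ᶜ Black))

  blackDegree-allBlack : ∀ end v →
    blackDegree end (λ _ → Black) v ≡ countE G (λ e → does (end e ≟ v))
  blackDegree-allBlack end v = countE-cong G λ e → ∧-identityʳ (does (end e ≟ v))

  blackDegree-none : ∀ end c v → (∀ e → end e ≡ v → c e ≢ Black) → blackDegree end c v ≡ 0
  blackDegree-none end c v noBlack = countE-false G notBlack
    where
    notBlack : ∀ e → does (end e ≟ v) ∧ (c e ==ᶜ Black) ≡ false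
    notBlack e with end e ≟ v
    ... | yes end≡v = ==ᶜBlack-≢ (noBlack e end≡v)
    ... | no  _     = refl

  setC-same : ∀ c e X → setC c e X e ≡ X
  setC-same c e X = cong (λ b → if b then X else c e) (dec-true (e ≟ e) refl)

  setC-other : ∀ c {e x} X → x ≢ e → setC c e X x ≡ c x
  setC-other c {e} {x} X x≢e = cong (λ b → if b then X else c x) (dec-false (x ≟ e) x≢e)

  blackDegree-setC : ∀ end c e X v {β β′} → (c e ==ᶜ Black) ≡ β → (X ==ᶜ Black) ≡ β′ →
    blackDegree end c v + 𝟙 (does (end e ≟ v) ∧ β′) ≡
    blackDegree end (setC c e X) v + 𝟙 (does (end e ≟ v) ∧ β)
  blackDegree-setC end c e X v {β} {β′} c≡β X≡β′ = begin
    blackDegree end c v + 𝟙 (at-e β′)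
      ≡⟨ cong (λ β → blackDegree end c v + 𝟙 (at-e β)) (sym setC≡β′) ⟩
    blackDegree end c v + 𝟙 (at-e (setC c e X e ==ᶜ Black))
      ≡⟨ countE-update G _ _ e agree ⟩
    blackDegree end (setC c e X) v + 𝟙 (at-e (c e ==ᶜ Black))
      ≡⟨ cong (λ β → blackDegree end (setC c e X) v + 𝟙 (at-e β)) c≡β ⟩
    blackDegree end (setC c e X) v + 𝟙 (at-e β) ∎
    where
    at-e : Bool → Bool
    at-e β = does (end e ≟ v) ∧ β

    setC≡β′ : (setC c e X e ==ᶜ Black) ≡ β′
    setC≡β′ = trans (cong (_==ᶜ Black) (setC-same c e X)) X≡β′

    agree : ∀ x → x ≢ e →
      does (end x ≟ v) ∧ (c x ==ᶜ Black) ≡ does (end x ≟ v) ∧ (setC c e X x ==ᶜ Black)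
    agree x x≢e = cong (λ Y → does (end x ≟ v) ∧ (Y ==ᶜ Black)) (sym (setC-other c X x≢e))

  blackDegree-unblacken : ∀ end c e X → c e ≡ Black → (X ==ᶜ Black) ≡ false →
    ∀ v → blackDegree end c v ≡ blackDegree end (setC c e X) v + δ (end e) v
  blackDegree-unblacken end c e X c≡Black X≢Black v = begin
    blackDegree end c v
      ≡⟨ sym (+-identityʳ _) ⟩
    blackDegree end c v + 𝟙 false
      ≡⟨ cong (λ b → blackDegree end c v + 𝟙 b) (sym (∧-zeroʳ (does (end e ≟ v)))) ⟩
    blackDegree end c v + 𝟙 (does (end e ≟ v) ∧ false)
      ≡⟨ blackDegree-setC end c e X v (cong (_==ᶜ Black) c≡Black) X≢Black ⟩
    blackDegree end (setC c e X) v + 𝟙 (does (end e ≟ v) ∧ true)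
      ≡⟨ cong (λ b → blackDegree end (setC c e X) v + 𝟙 b) (∧-identityʳ (does (end e ≟ v))) ⟩
    blackDegree end (setC c e X) v + δ (end e) v ∎

  blackDegree-recolour : ∀ end c e X → (c e ==ᶜ Black) ≡ false → (X ==ᶜ Black) ≡ false →
    ∀ v → blackDegree end (setC c e X) v ≡ blackDegree end c v
  blackDegree-recolour end c e X c≢Black X≢Black v =
    sym (+-cancelʳ-≡ _ _ _ (blackDegree-setC end c e X v c≢Black X≢Black))

  BlackTrail : State G → Set
  BlackTrail s = ∃ λ N →
    TrailDegrees (blackDegree src c) (blackDegree tgt c) N (State.current s)
    where c = State.colour s

  forward-step : ∀ {c e X N} → c e ≡ Black → (X ==ᶜ Black) ≡ false →
    TrailDegrees (blackDegree src c) (blackDegree tgt c) N (tgt e) →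
    TrailDegrees (blackDegree src (setC c e X)) (blackDegree tgt (setC c e X)) N (src e)
  forward-step {c} {e} {X} c≡Black X≢Black trail = trailDegrees-dropLast trail
    (blackDegree-unblacken src c e X c≡Black X≢Black)
    (blackDegree-unblacken tgt c e X c≡Black X≢Black)

  backward-step : ∀ {c e u N} w → (∀ e′ → tgt e′ ≡ u → c e′ ≢ Black) → (c e ==ᶜ Black) ≡ false →
    TrailDegrees (blackDegree src c) (blackDegree tgt c) N u →
    TrailDegrees (blackDegree src (setC c e Dashed)) (blackDegree tgt (setC c e Dashed)) w w
  backward-step {c} {e} {u} w noBlackIn c≢Black trail = balanced⇒trailDegrees λ v → begin
    blackDegree src (setC c e Dashed) v ≡⟨ blackDegree-recolour src c e Dashed c≢Black refl v ⟩
    blackDegree src c v                 ≡⟨ trailDegrees-closed trail noBlackEdgeIn v ⟩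
    blackDegree tgt c v                 ≡⟨ sym (blackDegree-recolour tgt c e Dashed c≢Black refl v) ⟩
    blackDegree tgt (setC c e Dashed) v ∎
    where
    noBlackEdgeIn : blackDegree tgt c u ≡ 0
    noBlackEdgeIn = blackDegree-none tgt c u noBlackIn

  step-preserves : ∀ {s t} → Step s t → BlackTrail s → BlackTrail t
  step-preserves (forward-red   _ c≡Black refl _) (N , trail) = N , forward-step c≡Black refl trail
  step-preserves (forward-green _ c≡Black refl _) (N , trail) = N , forward-step c≡Black refl trail
  step-preserves (back-green e noBlackIn c≡Green _) (_ , trail) =
    tgt e , backward-step (tgt e) noBlackIn (cong (_==ᶜ Black) c≡Green) trail
  step-preserves (back-red e noBlackIn _ _ c≡Red _) (_ , trail) =
    tgt e , backward-step (tgt e) noBlackIn (cong (_==ᶜ Black) c≡Red) trail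

  steps-preserve : ∀ {s t} → Star Step s t → BlackTrail s → BlackTrail t
  steps-preserve ε          = id
  steps-preserve (st ◅ sts) = steps-preserve sts ∘ step-preserves st

  initial-blackTrail : (∀ v → outDeg G v ≡ inDeg G v) → BlackTrail initial
  initial-blackTrail balanced = v₀ , balanced⇒trailDegrees λ v → begin
    blackDegree src (λ _ → Black) v ≡⟨ blackDegree-allBlack src v ⟩
    outDeg G v                      ≡⟨ balanced v ⟩
    inDeg G v                       ≡⟨ sym (blackDegree-allBlack tgt v) ⟩
    blackDegree tgt (λ _ → Black) v ∎

  blackTrail⇒∃!needle : ∀ s → BlackTrail s → ∃! _≡_ (Needle s)
  blackTrail⇒∃!needle s (_ , trail) = trailDegrees⇒∃!needle trail

corollary4 : (G : Graph) → Eulerian G → (v₀ : Fin (Graph.n G)) →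
    (s : State G) → Procedure.Reachable G v₀ s →
    ∃! _≡_ (Procedure.Needle G v₀ s)
corollary4 G (_ , balanced) v₀ s reachable =
  blackTrail⇒∃!needle s (steps-preserve reachable (initial-blackTrail balanced))
  where open NeedleInvariant G v₀
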